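{- Let $m\ge1$. For every $\pi\in L^+_{4m+2,4}$, $h^+_m(\pi)=h^-_{(4m+2)/4}(\pi)$.
   Context: For positive integers $r,s$, an $r\times s$ Dyck path is a lattice path from $(0,0)$ to $(r,s)$ with unit north and east steps that never goes below the line segment from $(0,0)$ to $(r,s)$; $L^+_{r,s}$ is the set of these. For $\pi\in L^+_{r,s}$, the unit lattice squares in the triangle with vertices $(0,0),(0,s),(r,s)$ lying above $\pi$ form a partition diagram $D(\pi)$ (justified at the upper-left corner $(0,s)$). For a cell $c\in D(\pi)$, its arm $a(c)$ is the number of cells of $D(\pi)$ to its right in the same row and its leg $l(c)$ is the number of cells of $D(\pi)$ below it in the same column. For a positive real $x$ define $h^+_x(\pi)=\#\{c\in D(\pi):\frac{a(c)}{l(c)+1}\le x<\frac{a(c)+1}{l(c)}\}$ and $h^-_x(\pi)=\#\{c\in D(\pi):\frac{a(c)}{l(c)+1}<x\le\frac{a(c)+1}{l(c)}\}$, with the convention $\frac{a(c)+1}{0}=+\infty$. -}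

module Defs where

open import Data.Nat using (ℕ; zero; suc; _+_; _*_; _≤_; _≤ᵇ_; _<ᵇ_)
open import Data.Bool using (Bool; true; false; _∧_; if_then_else_)
open import Data.List using (List; []; _∷_)
open import Data.Product using (_×_)
open import Relation.Binary.PropositionalEquality using (_≡_)

data Step : Set where
  N E : Step

numN numE : List Step → ℕ
numN []      = 0
numN (N ∷ π) = suc (numN π)
numN (E ∷ π) = numN π
numE []      = 0
numE (N ∷ π) = numE π
numE (E ∷ π) = suc (numE π)

-- Starting from the lattice point (x , y), every visited lattice point
-- (x' , y') of the path satisfies y' ≥ (s/r) x', i.e. x' * s ≤ y' * r
-- (the point is weakly above the line through (0,0) and (r,s)).
AboveFrom : ℕ → ℕ → ℕ → ℕ → List Step → Set
AboveFrom r s x y []      = x * s ≤ y * r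
AboveFrom r s x y (N ∷ π) = x * s ≤ y * r × AboveFrom r s x (suc y) π
AboveFrom r s x y (E ∷ π) = x * s ≤ y * r × AboveFrom r s (suc x) y π

-- π ∈ L⁺_{r,s}: a path from (0,0) to (r,s) with r east and s north steps,
-- never going below the segment from (0,0) to (r,s).
IsDyck : ℕ → ℕ → List Step → Set
IsDyck r s π = (numE π ≡ r) × (numN π ≡ s) × AboveFrom r s 0 0 π

-- height (y-coordinate) of the (i+1)-th east step of π, i.e. the height of
-- π over the column [i , i+1].
colHeight : List Step → ℕ → ℕ
colHeight []      i       = 0
colHeight (N ∷ π) i       = suc (colHeight π i)
colHeight (E ∷ π) zero    = 0
colHeight (E ∷ π) (suc i) = colHeight π i

-- The unit cell [i,i+1]×[j,j+1] belongs to D(π): it lies in the triangle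
-- (0,0),(0,s),(r,s) (i.e. i<r, j<s and its lower-right corner (i+1,j) is
-- weakly above the diagonal: (i+1)*s ≤ j*r) and it lies above π (j ≥ height
-- of π over column i).
inD : ℕ → ℕ → List Step → ℕ → ℕ → Bool
inD r s π i j = (i <ᵇ r) ∧ (j <ᵇ s) ∧ (colHeight π i ≤ᵇ j) ∧ (suc i * s ≤ᵇ j * r)

count : ℕ → (ℕ → Bool) → ℕ
count zero    f = 0
count (suc n) f = (if f n then 1 else 0) + count n f

arm : ℕ → ℕ → List Step → ℕ → ℕ → ℕ
arm r s π i j = count r (λ i' → (i <ᵇ i') ∧ inD r s π i' j)

leg : ℕ → ℕ → List Step → ℕ → ℕ → ℕ
leg r s π i j = count j (λ j' → inD r s π i j')

sumTo : ℕ → (ℕ → ℕ) → ℕ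
sumTo zero    f = 0
sumTo (suc n) f = f n + sumTo n f

countCells : ℕ → ℕ → List Step → (ℕ → ℕ → Bool) → ℕ
countCells r s π P =
  sumTo r (λ i → count s (λ j → inD r s π i j ∧ P (arm r s π i j) (leg r s π i j)))

-- The real parameter x is a positive rational x = p / q (q > 0).
-- h⁺_x(π) = #{c : a/(l+1) ≤ x < (a+1)/l}, with (a+1)/0 = +∞.
-- Cross-multiplied (q > 0, l+1 > 0): a*q ≤ p*(l+1)  and  p*l < q*(a+1)
-- (for l = 0 the second condition is 0 < q*(a+1), true, matching +∞).
hPlus : ℕ → ℕ → ℕ → ℕ → List Step → ℕ
hPlus p q r s π = countCells r s π
  (λ a l → (a * q ≤ᵇ p * suc l) ∧ (p * l <ᵇ q * suc a))

-- h⁻_x(π) = #{c : a/(l+1) < x ≤ (a+1)/l}: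
-- a*q < p*(l+1)  and  p*l ≤ q*(a+1).
hMinus : ℕ → ℕ → ℕ → ℕ → List Step → ℕ
hMinus p q r s π = countCells r s π
  (λ a l → (a * q <ᵇ p * suc l) ∧ (p * l ≤ᵇ q * suc a))

-- Every cell of D(π) lies in the triangle (0,0),(0,4),(4m+2,4), so it has leg l ≤ 2 and
-- arm a ≤ 3m.  Cross-multiplying, for such (a , l)
--   a/(l+1) ≤ m  ⇔  a/(l+1) < m + 1/2    and    m < (a+1)/l  ⇔  m + 1/2 ≤ (a+1)/l :
-- the shift by 1/2 is absorbed by the integrality of a as long as 2(l+1) ≤ 4, resp. 2l ≤ 4,
-- and in the remaining case l = 2 of the first equivalence both sides hold because a ≤ 3m.
-- Hence h⁺_m and h⁻_{m+1/2} count the same cells.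
module Submission where

open import Defs
open import Data.Bool using (Bool; true; false; _∧_; T; if_then_else_)
open import Data.Bool.Properties using (T-∧)
open import Data.List using (List)
open import Data.Nat using (ℕ; zero; suc; _+_; _*_; _∸_; _≤_; _<_; z≤n; s≤s; z<s; _≤ᵇ_; _<ᵇ_)
open import Data.Nat.Properties
open import Data.Nat.Tactic.RingSolver using (solve-∀)
open import Data.Product using (_×_; _,_; proj₁; proj₂)
open import Data.Unit using (tt)
open import Function using (const)
open import Function.Bundles using (_⇔_; mk⇔; Equivalence)
open import Function.Properties.Equivalence using () renaming (sym to ⇔-sym; trans to ⇔-trans)
open import Relation.Binary.PropositionalEquality using (_≡_; refl; sym; cong; cong₂; subst; module ≡-Reasoning)
open import Relation.Nullary using (¬_; contradiction)
open import Relation.Nullary.Reflects using (Reflects; ofʸ; ofⁿ)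

open Equivalence using (to; from)

reflects-⇔⇒≡ : ∀ {A B : Set} {b c : Bool} → Reflects A b → Reflects B c → A ⇔ B → b ≡ c
reflects-⇔⇒≡ (ofʸ _)  (ofʸ _)  _   = refl
reflects-⇔⇒≡ (ofʸ a)  (ofⁿ ¬b) A⇔B = contradiction (to A⇔B a) ¬b
reflects-⇔⇒≡ (ofⁿ ¬a) (ofʸ b)  A⇔B = contradiction (from A⇔B b) ¬a
reflects-⇔⇒≡ (ofⁿ _)  (ofⁿ _)  _   = refl

∧-congˡ-T : ∀ b {c d : Bool} → (T b → c ≡ d) → b ∧ c ≡ b ∧ d
∧-congˡ-T true  c≡d = c≡d tt
∧-congˡ-T false _   = refl

count-cong : ∀ n {f g : ℕ → Bool} → (∀ k → f k ≡ g k) → count n f ≡ count n g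
count-cong zero    f≡g = refl
count-cong (suc n) f≡g = cong₂ (λ b c → (if b then 1 else 0) + c) (f≡g n) (count-cong n f≡g)

sumTo-cong : ∀ n {f g : ℕ → ℕ} → (∀ k → f k ≡ g k) → sumTo n f ≡ sumTo n g
sumTo-cong zero    f≡g = refl
sumTo-cong (suc n) f≡g = cong₂ _+_ (f≡g n) (sumTo-cong n f≡g)

count-≤-pred : ∀ n (f : ℕ → Bool) → ¬ T (f 0) → count n f ≤ n ∸ 1
count-≤-pred zero          f _   = z≤n
count-≤-pred (suc zero)    f ¬f0 with f 0
... | false = z≤n
... | true  = contradiction tt ¬f0
count-≤-pred (suc (suc n)) f ¬f0 =
  +-mono-≤ (indicator≤1 (f (suc n))) (count-≤-pred (suc n) f ¬f0)
  where
  indicator≤1 : ∀ b → (if b then 1 else 0) ≤ 1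
  indicator≤1 false = z≤n
  indicator≤1 true  = ≤-refl

count-≤ : ∀ n (f : ℕ → Bool) {B} → ¬ T (f 0) → (∀ k → T (f k) → k ≤ B) → count n f ≤ B
count-≤ zero    f ¬f0 _ = z≤n
count-≤ (suc n) f ¬f0 bound with f n in fn
... | false = count-≤ n f ¬f0 bound
... | true  = ≤-trans (count<n n fn-holds) (bound n fn-holds)
  where
  fn-holds : T (f n)
  fn-holds = subst T (sym fn) tt
  count<n : ∀ n → T (f n) → count n f < n
  count<n zero    f0 = contradiction f0 ¬f0
  count<n (suc n) _  = s≤s (count-≤-pred (suc n) f ¬f0)

m*d<n*d+c⇔m≤n : ∀ {c d} m n → 0 < c → c ≤ d → m * d < n * d + c ⇔ m ≤ n
m*d<n*d+c⇔m≤n {c} {d} m n 0<c c≤d = mk⇔ sound complete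
  where
  open ≤-Reasoning
  sound : m * d < n * d + c → m ≤ n
  sound lt = ≮⇒≥ λ n<m → <⇒≱ lt (begin
    n * d + c ≤⟨ +-monoʳ-≤ (n * d) c≤d ⟩
    n * d + d ≡⟨ +-comm (n * d) d ⟩
    suc n * d ≤⟨ *-monoˡ-≤ d n<m ⟩
    m * d     ∎)
  complete : m ≤ n → m * d < n * d + c
  complete m≤n = ≤-<-trans (*-monoˡ-≤ d m≤n) (m<m+n (n * d) 0<c)

m*d+c≤[1+n]*d⇔m≤n : ∀ {c d} m n → 0 < c → c ≤ d → m * d + c ≤ suc n * d ⇔ m ≤ n
m*d+c≤[1+n]*d⇔m≤n {c} {d} m n 0<c c≤d = mk⇔ sound complete
  where
  open ≤-Reasoning
  sound : m * d + c ≤ suc n * d → m ≤ n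
  sound le = ≮⇒≥ λ n<m → <⇒≱ (m<m+n (m * d) 0<c) (begin
    m * d + c ≤⟨ le ⟩
    suc n * d ≤⟨ *-monoˡ-≤ d n<m ⟩
    m * d     ∎)
  complete : m ≤ n → m * d + c ≤ suc n * d
  complete m≤n = begin
    m * d + c ≤⟨ +-mono-≤ (*-monoˡ-≤ d m≤n) c≤d ⟩
    n * d + d ≡⟨ +-comm (n * d) d ⟩
    suc n * d ∎

inD⇒inTriangle : ∀ r s π i j → T (inD r s π i j) → j < s × suc i * s ≤ j * r
inD⇒inTriangle r s π i j c∈D with to (T-∧ {i <ᵇ r}) c∈D
... | _ , rest with to (T-∧ {j <ᵇ s}) rest
... | j<ᵇs , rest′ with to (T-∧ {colHeight π i ≤ᵇ j}) rest′
... | _ , below-diagonal = <ᵇ⇒< j s j<ᵇs , ≤ᵇ⇒≤ _ _ below-diagonal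

leg-≤ : ∀ r s π i j → leg r (suc s) π i j ≤ j ∸ 1
leg-≤ r s π i j = count-≤-pred j (inD r (suc s) π i) bottom-row-empty
  where
  bottom-row-empty : ¬ T (inD r (suc s) π i 0)
  bottom-row-empty c∈D with proj₂ (inD⇒inTriangle r (suc s) π i 0 c∈D)
  ... | ()

arm-≤ : ∀ m π i j → arm (4 * m + 2) 4 π i j ≤ 3 * m
arm-≤ m π i j = count-≤ (4 * m + 2) _ (λ ()) bound
  where
  bound : ∀ k → T ((i <ᵇ k) ∧ inD (4 * m + 2) 4 π k j) → k ≤ 3 * m
  bound k c∈arm with inD⇒inTriangle (4 * m + 2) 4 π k j (proj₂ (to (T-∧ {i <ᵇ k}) c∈arm))
  ... | j<4 , below-diagonal =
    ≤-pred (to (m*d<n*d+c⇔m≤n (suc k) (1 + 3 * m) z<s (m≤n⇒m≤1+n ≤-refl)) [1+k]*4<[1+3m]*4+3)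
    where
    open ≤-Reasoning
    1+3*[4m+2]≡[1+3m]*4+3 : ∀ m → suc (3 * (4 * m + 2)) ≡ (1 + 3 * m) * 4 + 3
    1+3*[4m+2]≡[1+3m]*4+3 = solve-∀
    [1+k]*4<[1+3m]*4+3 : suc k * 4 < (1 + 3 * m) * 4 + 3
    [1+k]*4<[1+3m]*4+3 = begin-strict
      suc k * 4              ≤⟨ below-diagonal ⟩
      j * (4 * m + 2)        ≤⟨ *-monoˡ-≤ (4 * m + 2) (≤-pred j<4) ⟩
      3 * (4 * m + 2)        <⟨ n<1+n _ ⟩
      suc (3 * (4 * m + 2))  ≡⟨ 1+3*[4m+2]≡[1+3m]*4+3 m ⟩
      (1 + 3 * m) * 4 + 3    ∎

-- The cell conditions of hPlus m 1 (x = m) and of hMinus (4m+2) 4 (x = m + 1/2).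
h⁺-criterion h⁻-criterion : ℕ → ℕ → ℕ → Bool
h⁺-criterion m a l = (a * 1 ≤ᵇ m * suc l) ∧ (m * l <ᵇ 1 * suc a)
h⁻-criterion m a l = (a * 4 <ᵇ (4 * m + 2) * suc l) ∧ ((4 * m + 2) * l ≤ᵇ 4 * suc a)

[4m+2]*l≡m*l*4+2*l : ∀ m l → (4 * m + 2) * l ≡ m * l * 4 + 2 * l
[4m+2]*l≡m*l*4+2*l = solve-∀

lower-criteria-agree : ∀ m a l → 2 * suc l ≤ 4 →
  (a * 1 ≤ᵇ m * suc l) ≡ (a * 4 <ᵇ (4 * m + 2) * suc l)
lower-criteria-agree m a l 2[l+1]≤4 = begin
  a * 1 ≤ᵇ m * suc l                   ≡⟨ cong (_≤ᵇ m * suc l) (*-identityʳ a) ⟩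
  a ≤ᵇ m * suc l                       ≡⟨ reflects-⇔⇒≡ (≤ᵇ-reflects-≤ _ _) (<ᵇ-reflects-< _ _)
                                            (⇔-sym (m*d<n*d+c⇔m≤n a (m * suc l) z<s 2[l+1]≤4)) ⟩
  a * 4 <ᵇ m * suc l * 4 + 2 * suc l   ≡⟨ cong (a * 4 <ᵇ_) (sym ([4m+2]*l≡m*l*4+2*l m (suc l))) ⟩
  a * 4 <ᵇ (4 * m + 2) * suc l         ∎
  where open ≡-Reasoning

upper-criteria-agree : ∀ m a l → 2 * suc l ≤ 4 →
  (m * suc l <ᵇ 1 * suc a) ≡ ((4 * m + 2) * suc l ≤ᵇ 4 * suc a)
upper-criteria-agree m a l 2[l+1]≤4 = begin
  m * suc l <ᵇ 1 * suc a                   ≡⟨ cong (m * suc l <ᵇ_) (*-identityˡ (suc a)) ⟩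
  m * suc l <ᵇ suc a                       ≡⟨ reflects-⇔⇒≡ (<ᵇ-reflects-< _ _) (≤ᵇ-reflects-≤ _ _)
                                                (⇔-trans (mk⇔ m<1+n⇒m≤n s≤s)
                                                  (⇔-sym (m*d+c≤[1+n]*d⇔m≤n (m * suc l) a z<s 2[l+1]≤4))) ⟩
  m * suc l * 4 + 2 * suc l ≤ᵇ suc a * 4   ≡⟨ cong₂ _≤ᵇ_ (sym ([4m+2]*l≡m*l*4+2*l m (suc l))) (*-comm (suc a) 4) ⟩
  (4 * m + 2) * suc l ≤ᵇ 4 * suc a         ∎
  where open ≡-Reasoning

criteria-agree : ∀ m a l → l ≤ 2 → a ≤ 3 * m → h⁺-criterion m a l ≡ h⁻-criterion m a l
criteria-agree m a _ l≤2 a≤3m = cong₂ _∧_ (lower l≤2) (upper l≤2)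
  where
  lower : ∀ {l} → l ≤ 2 → (a * 1 ≤ᵇ m * suc l) ≡ (a * 4 <ᵇ (4 * m + 2) * suc l)
  lower z≤n             = lower-criteria-agree m a 0 (s≤s (s≤s z≤n))
  lower (s≤s z≤n)       = lower-criteria-agree m a 1 ≤-refl
  lower (s≤s (s≤s z≤n)) = reflects-⇔⇒≡ (≤ᵇ-reflects-≤ _ _) (<ᵇ-reflects-< _ _)
                            (mk⇔ (const a*4<[4m+2]*3) (const a*1≤m*3))
    where
    a*1≤m*3 : a * 1 ≤ m * 3
    a*1≤m*3 rewrite *-identityʳ a | *-comm m 3 = a≤3m
    a*4<[4m+2]*3 : a * 4 < (4 * m + 2) * 3
    a*4<[4m+2]*3 rewrite [4m+2]*l≡m*l*4+2*l m 3 | *-comm m 3 =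
      ≤-<-trans (*-monoˡ-≤ 4 a≤3m) (m<m+n (3 * m * 4) z<s)
  upper : ∀ {l} → l ≤ 2 → (m * l <ᵇ 1 * suc a) ≡ ((4 * m + 2) * l ≤ᵇ 4 * suc a)
  upper z≤n             = reflects-⇔⇒≡ (<ᵇ-reflects-< _ _) (≤ᵇ-reflects-≤ _ _)
                            (mk⇔ (const (subst (_≤ 4 * suc a) (sym (*-zeroʳ (4 * m + 2))) z≤n))
                                 (const (subst (_< 1 * suc a) (sym (*-zeroʳ m)) z<s)))
  upper (s≤s z≤n)       = upper-criteria-agree m a 0 (s≤s (s≤s z≤n))
  upper (s≤s (s≤s z≤n)) = upper-criteria-agree m a 1 ≤-refl

cell-agree : ∀ m π i j → let r = 4 * m + 2 in
  inD r 4 π i j ∧ h⁺-criterion m (arm r 4 π i j) (leg r 4 π i j) ≡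
  inD r 4 π i j ∧ h⁻-criterion m (arm r 4 π i j) (leg r 4 π i j)
cell-agree m π i j = ∧-congˡ-T (inD r 4 π i j) λ c∈D →
  criteria-agree m _ _ (leg≤2 c∈D) (arm-≤ m π i j)
  where
  r : ℕ
  r = 4 * m + 2
  leg≤2 : T (inD r 4 π i j) → leg r 4 π i j ≤ 2
  leg≤2 c∈D =
    ≤-trans (leg-≤ r 3 π i j) (∸-monoˡ-≤ 1 (≤-pred (proj₁ (inD⇒inTriangle r 4 π i j c∈D))))

lemma6p1 : (m : ℕ) → 1 ≤ m → (π : List Step) → IsDyck (4 * m + 2) 4 π →
    hPlus m 1 (4 * m + 2) 4 π ≡ hMinus (4 * m + 2) 4 (4 * m + 2) 4 π
lemma6p1 m _ π _ = sumTo-cong (4 * m + 2) λ i → count-cong 4 λ j → cell-agree m π i j
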